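{- Let $G$ be a graph, $M=M[IAS(G)]$, and $X\subseteq V(G)$. Then $c_G(X)<\min\{|X|,|V(G)-X|\}$ if and only if there is a $k\ge1$ such that $\tau_G(X)$ is a vertical $k$-separation of $M$. If this is the case, then the smallest $k$ for which $\tau_G(X)$ is a vertical $k$-separation of $M$ is $k=2c_G(X)+1$.
   Context: A graph is a finite looped simple graph; $A=A(G)$ is its $GF(2)$ adjacency matrix (diagonal 1 iff looped). $M[IAS(G)]$ is the binary matroid represented by $(I\;A\;A+I)$, with elements $\phi_G(v),\chi_G(v),\psi_G(v)$ corresponding to the $v$ columns of $I$, $A$, $A+I$; $\tau_G(X)=\bigcup_{x\in X}\{\phi_G(x),\chi_G(x),\psi_G(x)\}$. For a matroid on $W$ with rank $r$, $\lambda(S)=r(S)+r(W-S)-r(M)$, and $S$ is a vertical $k$-separation if $\lambda(S)<k$ and $r(S),r(W-S)\ge k$. The cut-rank is $c_G(X)=r(A[V(G)-X,X])$ over $GF(2)$. -}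

module Defs where

open import Data.Bool using (Bool; true; false; not; _∧_; _∨_; _xor_; if_then_else_)
open import Data.Nat using (ℕ; zero; suc; _+_; _∸_; _<_; _≤_; _⊔_; _≡ᵇ_)
open import Data.Fin using (Fin; zero; suc; splitAt; _≟_)
open import Data.Fin.Subset using (Subset; ∣_∣; ∁; ⊤)
open import Data.Vec using (Vec; []; _∷_; lookup; _++_)
open import Data.List using (List; []; _∷_; [_]; map; foldr; allFin) renaming (_++_ to _++ₗ_)
open import Data.Sum using (inj₁; inj₂)
open import Data.Product using (_×_)
open import Relation.Nullary.Decidable using (⌊_⌋)

-- Graphs: a looped simple graph on vertex set Fin n is given by its
-- GF(2) adjacency matrix (Bool = GF(2), true = 1, xor = +, ∧ = ·),
-- which must be symmetric; A v v = true iff v carries a loop.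

AdjMatrix : ℕ → Set
AdjMatrix n = Fin n → Fin n → Bool

Symmetric : {n : ℕ} → AdjMatrix n → Set
Symmetric {n} A = (i j : Fin n) → A i j ≡ A j i
  where open import Relation.Binary.PropositionalEquality using (_≡_)

-- Binary matroids given by a representation: m columns, each a vector
-- in GF(2)^n (column i, row j ↦ entry).

Columns : ℕ → ℕ → Set
Columns n m = Fin m → Fin n → Bool

allₗ : {A : Set} → (A → Bool) → List A → Bool
allₗ p = foldr (λ x b → p x ∧ b) true

allSubsets : (m : ℕ) → List (Subset m)
allSubsets zero    = [ [] ]
allSubsets (suc m) = map (false ∷_) (allSubsets m) ++ₗ map (true ∷_) (allSubsets m)

_⊆ᵇ_ : {m : ℕ} → Subset m → Subset m → Bool
[]      ⊆ᵇ []      = true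
(t ∷ T) ⊆ᵇ (s ∷ S) = (not t ∨ s) ∧ (T ⊆ᵇ S)

sumCols : {n m : ℕ} → Subset m → Columns n m → Fin n → Bool
sumCols []      c j = false
sumCols (b ∷ T) c j = (b ∧ c zero j) xor sumCols T (λ i → c (suc i)) j

isZeroVec : {n : ℕ} → (Fin n → Bool) → Bool
isZeroVec {n} v = allₗ (λ j → not (v j)) (allFin n)

independent : {n m : ℕ} → Columns n m → Subset m → Bool
independent {n} {m} c S =
  allₗ (λ T → not (T ⊆ᵇ S) ∨ (∣ T ∣ ≡ᵇ 0) ∨ not (isZeroVec (sumCols T c)))
       (allSubsets m)

rank : {n m : ℕ} → Columns n m → Subset m → ℕ
rank {n} {m} c S =
  foldr (λ T acc → if (T ⊆ᵇ S) ∧ independent c T then ∣ T ∣ ⊔ acc else acc)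
        0 (allSubsets m)

connectivity : {n m : ℕ} → Columns n m → Subset m → ℕ
connectivity c S = (rank c S + rank c (∁ S)) ∸ rank c ⊤

VerticalSeparation : {n m : ℕ} → Columns n m → ℕ → Subset m → Set
VerticalSeparation c k S =
  (connectivity c S < k) × (k ≤ rank c S) × (k ≤ rank c (∁ S))

-- M[IAS(G)]: represented by (I  A  A+I), ground set Fin (n + (n + n)):
-- the first block is φ_G(v), the second χ_G(v), the third ψ_G(v).

IAS : {n : ℕ} → AdjMatrix n → Columns n (n + (n + n))
IAS {n} A i j with splitAt n i
... | inj₁ v = ⌊ j ≟ v ⌋
... | inj₂ w with splitAt n w
...   | inj₁ v = A j v
...   | inj₂ v = A j v xor ⌊ j ≟ v ⌋

τ : {n : ℕ} → Subset n → Subset (n + (n + n))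
τ X = X ++ (X ++ X)

-- cut-rank c_G(X) = GF(2)-rank of A[V(G) - X, X]: the column rank of the
-- columns v ∈ X of A, restricted to the rows j ∉ X (rows in X are zeroed,
-- which does not change the rank).
cutRank : {n : ℕ} → AdjMatrix n → Subset n → ℕ
cutRank A X = rank (λ v j → A j v ∧ not (lookup X j)) X

module Submission where

-- The whole proposition follows from three rank computations:
--   r(τ X) = |X| + c(X),   r(M) = |V|,   c(V - X) = c(X)  (A symmetric).
-- Since ∁ τ(X) = τ(V - X), they give λ(τ X) = 2c(X), r(τ X) = |X| + c(X) and
-- r(∁ τ X) = |V - X| + c(X), so τ X is a vertical k-separation exactly when
-- 2c(X) < k ≤ min(|X|, |V - X|) + c(X); both claims are then arithmetic.
--
-- For r(τ X): the
-- columns of τ X are spanned by the unit vectors eₓ (x ∈ X) and a basis B of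
-- A[V - X, X], and conversely φ(X) ∪ χ(B) is independent.  Symmetry of the
-- cut-rank is row rank = column rank for the transposed blocks of A.

open import Defs
open import Data.Nat using (ℕ; zero; suc; _<_; _≤_; _+_; _*_; _∸_; _⊓_; _⊔_; _≡ᵇ_; z≤n; s≤s; s≤s⁻¹)
import Data.Nat.Properties as ℕ
open import Data.Bool using (Bool; true; false; not; _∧_; _∨_; _xor_; if_then_else_)
open import Data.Bool.Properties
  using (xor-assoc; xor-comm; xor-same; xor-identityʳ; ∧-comm; ∧-zeroʳ; ∧-identityʳ;
         ∧-distribˡ-xor; not-involutive; xor-∧-commutativeRing)
open import Data.Fin using (Fin; zero; suc; _↑ˡ_; _↑ʳ_; splitAt; _≟_)
import Data.Fin.Properties as Fin
open import Data.Fin.Subset using (Subset; ∣_∣; ∁) renaming (⊥ to ∅; ⊤ to full)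
open import Data.Fin.Subset.Properties using (∣⊥∣≡0; ∣⊤∣≡n; ∣∁p∣≡n∸∣p∣; ∣p∣≤n; ∣p∣≤∣x∷p∣)
open import Data.Vec using (_∷_; []; lookup; _++_; _[_]≔_; tabulate; replicate; map)
open import Data.Vec.Properties
  using (lookup-replicate; lookup∘update; lookup∘update′; lookup-++ˡ; lookup-++ʳ;
         lookup∘tabulate; lookup-map; map-++)
open import Data.List using (List; []; _∷_; foldr; allFin) renaming (map to mapₗ)
open import Data.List.Membership.Propositional using (_∈_)
open import Data.List.Membership.Propositional.Properties using (∈-map⁺; ∈-++⁺ˡ; ∈-++⁺ʳ; ∈-allFin)
open import Data.List.Relation.Unary.Any using (here; there)
open import Data.Product using (_×_; _,_; proj₁; proj₂; ∃; ∃-syntax)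
open import Data.Sum using (_⊎_; inj₁; inj₂; [_,_]′)
open import Data.Empty using (⊥-elim)
open import Function using (_∘_)
open import Function.Bundles using (_⇔_; mk⇔)
open import Relation.Nullary using (¬_; yes; no)
open import Relation.Nullary.Decidable using (⌊_⌋)
open import Relation.Binary.PropositionalEquality
open import Algebra.Bundles using (CommutativeRing; CommutativeMonoid)
open import Algebra.Properties.CommutativeSemigroup
  (CommutativeMonoid.commutativeSemigroup (CommutativeRing.+-commutativeMonoid xor-∧-commutativeRing))
  using () renaming (interchange to xor-interchange)
open import Algebra.Properties.CommutativeSemigroup ℕ.+-commutativeSemigroup
  using () renaming (interchange to +-interchange)

dot : ∀ {m} → (Fin m → Bool) → (Fin m → Bool) → Bool
dot {zero}  u f = false
dot {suc m} u f = (u zero ∧ f zero) xor dot (u ∘ suc) (f ∘ suc)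

dot-cong : ∀ {m} {u f u′ f′ : Fin m → Bool} →
  (∀ i → u i ∧ f i ≡ u′ i ∧ f′ i) → dot u f ≡ dot u′ f′
dot-cong {zero}  h = refl
dot-cong {suc m} h = cong₂ _xor_ (h zero) (dot-cong (h ∘ suc))

dot-zero : ∀ {m} {u f : Fin m → Bool} → (∀ i → u i ∧ f i ≡ false) → dot u f ≡ false
dot-zero {zero}  h = refl
dot-zero {suc m} h rewrite h zero = dot-zero (h ∘ suc)

dot-xorʳ : ∀ {m} (u f g : Fin m → Bool) → dot u (λ i → f i xor g i) ≡ dot u f xor dot u g
dot-xorʳ {zero}  u f g = refl
dot-xorʳ {suc m} u f g =
  trans (cong₂ _xor_ (∧-distribˡ-xor (u zero) (f zero) (g zero)) (dot-xorʳ (u ∘ suc) (f ∘ suc) (g ∘ suc)))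
        (xor-interchange (u zero ∧ f zero) (u zero ∧ g zero) (dot (u ∘ suc) (f ∘ suc)) (dot (u ∘ suc) (g ∘ suc)))

dot-scaleʳ : ∀ {m} (u f : Fin m → Bool) b → dot u (λ i → b ∧ f i) ≡ b ∧ dot u f
dot-scaleʳ u f true  = refl
dot-scaleʳ u f false = dot-zero (λ i → ∧-zeroʳ (u i))

dot-comm : ∀ {m} (u f : Fin m → Bool) → dot u f ≡ dot f u
dot-comm u f = dot-cong (λ i → ∧-comm (u i) (f i))

dot-swap : ∀ {m q} (x : Fin m → Bool) (y : Fin q → Bool) (a : Fin m → Fin q → Bool) →
  dot x (λ i → dot y (a i)) ≡ dot y (λ t → dot x (λ i → a i t))
dot-swap {zero}  x y a = sym (dot-zero (λ t → ∧-zeroʳ (y t)))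
dot-swap {suc m} x y a = begin
    (x zero ∧ dot y (a zero)) xor dot (x ∘ suc) (λ i → dot y (a (suc i)))
  ≡⟨ cong₂ _xor_ (sym (dot-scaleʳ y (a zero) (x zero))) (dot-swap (x ∘ suc) y (a ∘ suc)) ⟩
    dot y (λ t → x zero ∧ a zero t) xor dot y (λ t → dot (x ∘ suc) (λ i → a (suc i) t))
  ≡⟨ sym (dot-xorʳ y _ _) ⟩
    dot y (λ t → dot x (λ i → a i t))
  ∎
  where open ≡-Reasoning

dot-unitʳ : ∀ {m} (u : Fin m → Bool) (j : Fin m) → dot u (λ t → ⌊ j ≟ t ⌋) ≡ u j
dot-unitʳ u zero =
  trans (cong₂ _xor_ (∧-identityʳ (u zero)) (dot-zero (λ t → ∧-zeroʳ (u (suc t))))) (xor-identityʳ (u zero))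
dot-unitʳ u (suc j) = begin
    (u zero ∧ false) xor dot (u ∘ suc) (λ t → ⌊ suc j ≟ suc t ⌋)
  ≡⟨ cong₂ _xor_ (∧-zeroʳ (u zero)) (dot-cong (λ t → cong (u (suc t) ∧_) (≟-suc j t))) ⟩
    dot (u ∘ suc) (λ t → ⌊ j ≟ t ⌋)
  ≡⟨ dot-unitʳ (u ∘ suc) j ⟩
    u (suc j)
  ∎
  where
  open ≡-Reasoning
  ≟-suc : ∀ {m} (j t : Fin m) → ⌊ suc j ≟ suc t ⌋ ≡ ⌊ j ≟ t ⌋
  ≟-suc j t with j ≟ t
  ... | yes _ = refl
  ... | no _  = refl

dot-unitˡ : ∀ {m} (f : Fin m → Bool) (j : Fin m) → dot (λ t → ⌊ j ≟ t ⌋) f ≡ f j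
dot-unitˡ f j = trans (dot-comm _ f) (dot-unitʳ f j)

dot-split : ∀ a {b} (u f : Fin (a + b) → Bool) →
  dot u f ≡ dot (λ k → u (k ↑ˡ b)) (λ k → f (k ↑ˡ b)) xor dot (u ∘ (a ↑ʳ_)) (f ∘ (a ↑ʳ_))
dot-split zero    u f = refl
dot-split (suc a) u f =
  trans (cong ((u zero ∧ f zero) xor_) (dot-split a (u ∘ suc) (f ∘ suc))) (sym (xor-assoc (u zero ∧ f zero) _ _))

-- The GF(2) identity behind changing one coefficient u into x:
-- x f + r = (u f + r) + (u + x) f.
change-coefficient : ∀ u x f r → (x ∧ f) xor r ≡ ((u ∧ f) xor r) xor ((u xor x) ∧ f)
change-coefficient true  true  f r = sym (xor-identityʳ (f xor r))
change-coefficient false false f r = sym (xor-identityʳ r)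
change-coefficient false true  f r = xor-comm f r
change-coefficient true  false f r = begin
    r                    ≡⟨ sym (xor-identityʳ r) ⟩
    r xor false          ≡⟨ cong (r xor_) (sym (xor-same f)) ⟩
    r xor (f xor f)      ≡⟨ sym (xor-assoc r f f) ⟩
    (r xor f) xor f      ≡⟨ cong (_xor f) (xor-comm r f) ⟩
    (f xor r) xor f      ∎
  where open ≡-Reasoning

dot-update : ∀ {m} (U : Subset m) v x (f : Fin m → Bool) →
  dot (lookup (U [ v ]≔ x)) f ≡ dot (lookup U) f xor ((lookup U v xor x) ∧ f v)
dot-update (u ∷ U) zero    x f = change-coefficient u x (f zero) (dot (lookup U) (f ∘ suc))
dot-update (u ∷ U) (suc v) x f =
  trans (cong ((u ∧ f zero) xor_) (dot-update U v x (f ∘ suc))) (sym (xor-assoc (u ∧ f zero) _ _))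

false≢true : false ≢ true
false≢true ()

-- β ≼ B: the vector β vanishes outside B.  For subsets, lookup U ≼ T is U ⊆ T.
infix 4 _≼_
_≼_ : ∀ {m} → (Fin m → Bool) → Subset m → Set
β ≼ B = ∀ i → β i ≡ true → lookup B i ≡ true

≼-outside : ∀ {m} {β : Fin m → Bool} B → β ≼ B → ∀ {i} → lookup B i ≡ false → β i ≡ false
≼-outside {β = β} B β≼B {i} i∉B with β i in βi
... | false = refl
... | true with trans (sym i∉B) (β≼B i βi)
...   | ()

∅-≼ : ∀ {m} {S : Subset m} → lookup ∅ ≼ S
∅-≼ i e with trans (sym (lookup-replicate i false)) e
... | ()

Nonzero : ∀ {m} → (Fin m → Bool) → Set
Nonzero u = ∃ λ i → u i ≡ true

combo : ∀ {n q} → (Fin q → Bool) → Columns n q → Fin n → Bool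
combo β d j = dot β (λ t → d t j)

sumCols-combo : ∀ {n m} (T : Subset m) (c : Columns n m) j → sumCols T c j ≡ combo (lookup T) c j
sumCols-combo []      c j = refl
sumCols-combo (b ∷ T) c j = cong ((b ∧ c zero j) xor_) (sumCols-combo T (c ∘ suc) j)

Dependency : ∀ {n m} → Columns n m → Subset m → Subset m → Set
Dependency c T U = (lookup U ≼ T) × Nonzero (lookup U) × (∀ j → combo (lookup U) c j ≡ false)

Independent : ∀ {n m} → Columns n m → Subset m → Set
Independent c T = independent c T ≡ true

allₗ-sound : ∀ {A : Set} (p : A → Bool) {l x} → allₗ p l ≡ true → x ∈ l → p x ≡ true
allₗ-sound p {y ∷ l} h x∈l with p y in eq | x∈l
allₗ-sound p {y ∷ l} h x∈l | true | here refl = eq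
allₗ-sound p {y ∷ l} h x∈l | true | there x∈ = allₗ-sound p h x∈
allₗ-sound p {y ∷ l} () x∈l | false | _

allₗ-complete : ∀ {A : Set} (p : A → Bool) (l : List A) → (∀ x → x ∈ l → p x ≡ true) → allₗ p l ≡ true
allₗ-complete p []      h = refl
allₗ-complete p (y ∷ l) h rewrite h y (here refl) = allₗ-complete p l (λ x → h x ∘ there)

allₗ-counterexample : ∀ {A : Set} (p : A → Bool) (l : List A) → allₗ p l ≡ false → ∃ λ x → p x ≡ false
allₗ-counterexample p (y ∷ l) h with p y in eq
... | true  = allₗ-counterexample p l h
... | false = y , eq

allSubsets-complete : ∀ {m} (T : Subset m) → T ∈ allSubsets m
allSubsets-complete []            = here refl
allSubsets-complete {suc m} (false ∷ T) = ∈-++⁺ˡ (∈-map⁺ (false ∷_) (allSubsets-complete T))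
allSubsets-complete {suc m} (true ∷ T)  =
  ∈-++⁺ʳ (mapₗ (false ∷_) (allSubsets m)) (∈-map⁺ (true ∷_) (allSubsets-complete T))

⊆ᵇ-complete : ∀ {m} (U T : Subset m) → lookup U ≼ T → (U ⊆ᵇ T) ≡ true
⊆ᵇ-complete []          []      h = refl
⊆ᵇ-complete (true ∷ U)  (t ∷ T) h rewrite h zero refl = ⊆ᵇ-complete U T (h ∘ suc)
⊆ᵇ-complete (false ∷ U) (t ∷ T) h = ⊆ᵇ-complete U T (h ∘ suc)

⊆ᵇ-sound : ∀ {m} (U T : Subset m) → (U ⊆ᵇ T) ≡ true → lookup U ≼ T
⊆ᵇ-sound (true ∷ U)  (true ∷ T) h zero    e = refl
⊆ᵇ-sound (true ∷ U)  (true ∷ T) h (suc i) e = ⊆ᵇ-sound U T h i e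
⊆ᵇ-sound (false ∷ U) (t ∷ T)    h (suc i) e = ⊆ᵇ-sound U T h i e

nonzero⇒∣∣≢ᵇ0 : ∀ {m} (U : Subset m) → Nonzero (lookup U) → (∣ U ∣ ≡ᵇ 0) ≡ false
nonzero⇒∣∣≢ᵇ0 (true ∷ U)  _           = refl
nonzero⇒∣∣≢ᵇ0 (false ∷ U) (suc i , e) = nonzero⇒∣∣≢ᵇ0 U (i , e)

∣∣>0⇒nonzero : ∀ {m} (U : Subset m) → 0 < ∣ U ∣ → Nonzero (lookup U)
∣∣>0⇒nonzero (true ∷ U)  _ = zero , refl
∣∣>0⇒nonzero (false ∷ U) h with ∣∣>0⇒nonzero U h
... | i , e = suc i , e

∣∣≢ᵇ0⇒nonzero : ∀ {m} (U : Subset m) → (∣ U ∣ ≡ᵇ 0) ≡ false → Nonzero (lookup U)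
∣∣≢ᵇ0⇒nonzero U h = ∣∣>0⇒nonzero U (positive h)
  where
  positive : ∀ {k} → (k ≡ᵇ 0) ≡ false → 0 < k
  positive {suc k} _ = s≤s z≤n

isZeroVec-sound : ∀ {n} (v : Fin n → Bool) → isZeroVec v ≡ true → ∀ j → v j ≡ false
isZeroVec-sound {n} v h j with v j | allₗ-sound (λ j → not (v j)) h (∈-allFin j)
... | false | _ = refl

isZeroVec-witness : ∀ {n} (v : Fin n → Bool) → isZeroVec v ≡ false → Nonzero v
isZeroVec-witness {n} v h with allₗ-counterexample (λ j → not (v j)) (allFin n) h
... | j , e = j , not-false e
  where
  not-false : ∀ {b} → not b ≡ false → b ≡ true
  not-false {true} _ = refl

independent-sound : ∀ {n m} (c : Columns n m) {T} U → Independent c T → ¬ Dependency c T U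
independent-sound {n} {m} c {T} U ind (U⊆T , U≢0 , ΣU≡0) =
  nonzero-sum (isZeroVec-witness (sumCols U c)
    (clause-false (allₗ-sound _ ind (allSubsets-complete U)) (⊆ᵇ-complete U T U⊆T) (nonzero⇒∣∣≢ᵇ0 U U≢0)))
  where
  clause-false : ∀ {a b z} → (not a ∨ b ∨ not z) ≡ true → a ≡ true → b ≡ false → z ≡ false
  clause-false {true} {false} {false} _ refl refl = refl
  nonzero-sum : ¬ Nonzero (sumCols U c)
  nonzero-sum (j , e) with trans (sym (sumCols-combo U c j)) e
  ... | e′ rewrite ΣU≡0 j = false≢true e′

independent-complete : ∀ {n m} (c : Columns n m) T → (∀ U → ¬ Dependency c T U) → Independent c T
independent-complete {n} {m} c T noDep = allₗ-complete _ (allSubsets m) clause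
  where
  clause : ∀ U → U ∈ allSubsets m → (not (U ⊆ᵇ T) ∨ (∣ U ∣ ≡ᵇ 0) ∨ not (isZeroVec (sumCols U c))) ≡ true
  clause U _ with U ⊆ᵇ T in U⊆T | ∣ U ∣ ≡ᵇ 0 in U≢0 | isZeroVec (sumCols U c) in ΣU≡0
  ... | false | _     | _     = refl
  ... | true  | true  | _     = refl
  ... | true  | false | false = refl
  ... | true  | false | true  = ⊥-elim (noDep U (⊆ᵇ-sound U T U⊆T , ∣∣≢ᵇ0⇒nonzero U U≢0 ,
                                  λ j → trans (sym (sumCols-combo U c j)) (isZeroVec-sound _ ΣU≡0 j)))

dependency-witness : ∀ {n m} (c : Columns n m) T → independent c T ≡ false → ∃ (Dependency c T)
dependency-witness {n} {m} c T h with allₗ-counterexample _ (allSubsets m) h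
... | U , e = read e refl refl refl
  where
  read : ∀ {a b z} → (not a ∨ b ∨ not z) ≡ false →
    (U ⊆ᵇ T) ≡ a → (∣ U ∣ ≡ᵇ 0) ≡ b → isZeroVec (sumCols U c) ≡ z → ∃ (Dependency c T)
  read {true} {false} {true} _ U⊆T U≢0 ΣU≡0 =
    U , ⊆ᵇ-sound U T U⊆T , ∣∣≢ᵇ0⇒nonzero U U≢0 , λ j → trans (sym (sumCols-combo U c j)) (isZeroVec-sound _ ΣU≡0 j)

module RankFold {m : ℕ} (good : Subset m → Bool) where
  step : Subset m → ℕ → ℕ
  step T acc = if good T then ∣ T ∣ ⊔ acc else acc

  max : List (Subset m) → ℕ
  max = foldr step 0

  max-≥ : ∀ l T → T ∈ l → good T ≡ true → ∣ T ∣ ≤ max l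
  max-≥ (y ∷ l) T (here refl) e rewrite e = ℕ.m≤m⊔n ∣ T ∣ _
  max-≥ (y ∷ l) T (there T∈) e with good y
  ... | true  = ℕ.≤-trans (max-≥ l T T∈ e) (ℕ.m≤n⊔m ∣ y ∣ _)
  ... | false = max-≥ l T T∈ e

  max-≤ : ∀ l r → (∀ T → good T ≡ true → ∣ T ∣ ≤ r) → max l ≤ r
  max-≤ []      r h = z≤n
  max-≤ (y ∷ l) r h with good y in e
  ... | true  = ℕ.⊔-lub (h y e) (max-≤ l r h)
  ... | false = max-≤ l r h

  max-attained : ∀ l → (max l ≡ 0) ⊎ (∃ λ T → good T ≡ true × max l ≡ ∣ T ∣)
  max-attained []      = inj₁ refl
  max-attained (y ∷ l) with good y in e
  ... | false = max-attained l
  ... | true with ℕ.⊔-sel ∣ y ∣ (max l) | max-attained l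
  ...   | inj₁ q | _                 = inj₂ (y , e , q)
  ...   | inj₂ q | inj₁ z            = inj₁ (trans q z)
  ...   | inj₂ q | inj₂ (T , eT , q′) = inj₂ (T , eT , trans q q′)

module _ {n m : ℕ} (c : Columns n m) (S : Subset m) where
  private
    good : Subset m → Bool
    good T = (T ⊆ᵇ S) ∧ independent c T
    open RankFold good

    good-sound : ∀ T → good T ≡ true → (lookup T ≼ S) × Independent c T
    good-sound T e with T ⊆ᵇ S in T⊆S | independent c T
    good-sound T refl | true | true = ⊆ᵇ-sound T S T⊆S , refl

  rank-≥ : ∀ T → lookup T ≼ S → Independent c T → ∣ T ∣ ≤ rank c S
  rank-≥ T T⊆S ind = max-≥ (allSubsets m) T (allSubsets-complete T)
    (subst (λ z → (z ∧ independent c T) ≡ true) (sym (⊆ᵇ-complete T S T⊆S)) ind)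

  rank-≤ : ∀ r → (∀ T → lookup T ≼ S → Independent c T → ∣ T ∣ ≤ r) → rank c S ≤ r
  rank-≤ r h = max-≤ (allSubsets m) r (λ T e → let (T⊆S , ind) = good-sound T e in h T T⊆S ind)

  rank-attained : ∃ λ B → (lookup B ≼ S) × Independent c B × rank c S ≡ ∣ B ∣
  rank-attained with max-attained (allSubsets m)
  ... | inj₂ (B , e , r≡) = B , proj₁ (good-sound B e) , proj₂ (good-sound B e) , r≡
  ... | inj₁ r≡0 = ∅ , ∅-≼ {S = S} ,
                   independent-complete c ∅ (λ { U (U⊆∅ , (i , e) , _) →
                     false≢true (trans (sym (≼-outside ∅ U⊆∅ (lookup-replicate i false))) e) }) ,
                   trans r≡0 (sym (∣⊥∣≡0 m))

independent-cong : ∀ {n m} {c c′ : Columns n m} → (∀ v j → c v j ≡ c′ v j) →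
  ∀ {T} → Independent c T → Independent c′ T
independent-cong {c = c} {c′} c≗c′ {T} ind = independent-complete c′ T λ U (U⊆T , U≢0 , ΣU≡0) →
  independent-sound c U ind (U⊆T , U≢0 , λ j → trans (dot-cong (λ v → cong (lookup U v ∧_) (c≗c′ v j))) (ΣU≡0 j))

rank-cong : ∀ {n m} {c c′ : Columns n m} → (∀ v j → c v j ≡ c′ v j) → ∀ S → rank c S ≡ rank c′ S
rank-cong {c = c} {c′} c≗c′ S = ℕ.≤-antisym (rank-≤-rank c≗c′) (rank-≤-rank (λ v j → sym (c≗c′ v j)))
  where
  rank-≤-rank : ∀ {d d′} → (∀ v j → d v j ≡ d′ v j) → rank d S ≤ rank d′ S
  rank-≤-rank {d} {d′} d≗d′ = rank-≤ d S _ λ T T⊆S ind → rank-≥ d′ S T T⊆S (independent-cong d≗d′ ind)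

card-remove : ∀ {m} (T : Subset m) i → lookup T i ≡ true → suc ∣ T [ i ]≔ false ∣ ≡ ∣ T ∣
card-remove (true ∷ T)  zero    _ = refl
card-remove (true ∷ T)  (suc i) e = cong suc (card-remove T i e)
card-remove (false ∷ T) (suc i) e = card-remove T i e

card-add : ∀ {m} (T : Subset m) i → lookup T i ≡ false → ∣ T [ i ]≔ true ∣ ≡ suc ∣ T ∣
card-add (false ∷ T) zero    _ = refl
card-add (true ∷ T)  (suc i) e = cong suc (card-add T i e)
card-add (false ∷ T) (suc i) e = card-add T i e

≼-except : ∀ {m} {β : Fin m → Bool} (T : Subset m) v {x} → β ≼ T [ v ]≔ x → β v ≡ false → β ≼ T
≼-except T v {x} β≼T′ βv≡0 i e with i ≟ v
... | yes refl with trans (sym e) βv≡0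
...   | ()
≼-except T v {x} β≼T′ βv≡0 i e | no i≢v = trans (sym (lookup∘update′ i≢v T x)) (β≼T′ i e)

≼-removed : ∀ {m} {β : Fin m → Bool} (T : Subset m) i₀ → β ≼ T [ i₀ ]≔ false →
  (β i₀ ≡ false) × (β ≼ T)
≼-removed {β = β} T i₀ β≼T′ = vanishes , ≼-except T i₀ β≼T′ vanishes
  where
  vanishes : β i₀ ≡ false
  vanishes with β i₀ in e
  ... | false = refl
  ... | true with trans (sym (lookup∘update i₀ T false)) (β≼T′ i₀ e)
  ...   | ()

-- § More than |B| vectors supported in B are dependent (Gaussian elimination)

pivot : ∀ {m} (T : Subset m) (g : Fin m → Bool) →
  (∃ λ i → lookup T i ≡ true × g i ≡ true) ⊎ (∀ i → lookup T i ≡ true → g i ≡ false)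
pivot []      g = inj₂ (λ ())
pivot (b ∷ T) g with b in eb | g zero in eg | pivot T (g ∘ suc)
... | true  | true  | _                   = inj₁ (zero , refl , eg)
... | _     | _     | inj₁ (i , e₁ , e₂)   = inj₁ (suc i , e₁ , e₂)
... | true  | false | inj₂ h = inj₂ λ { zero _ → eg ; (suc i) e → h i e }
... | false | _     | inj₂ h = inj₂ λ { zero () ; (suc i) e → h i e }

lift-dependency-tail : ∀ {m q} (a : Columns (suc q) m) (T : Subset m) →
  (∀ i → lookup T i ≡ true → a i zero ≡ false) →
  ∀ U → Dependency (λ i t → a i (suc t)) T U → Dependency a T U
lift-dependency-tail a T zero-on-T U (U⊆T , U≢0 , ΣU≡0) = U⊆T , U≢0 , λ
  { zero    → dot-zero (λ i → vanish (lookup U i) (λ e → zero-on-T i (U⊆T i e)))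
  ; (suc t) → ΣU≡0 t }
  where
  vanish : ∀ u {x} → (u ≡ true → x ≡ false) → u ∧ x ≡ false
  vanish true  h = h refl
  vanish false h = refl

reduce : ∀ {m q} → Columns (suc q) m → Fin m → Columns q m
reduce a i₀ i t = a i (suc t) xor (a i₀ (suc t) ∧ a i zero)

reduce-≼ : ∀ {m q} (a : Columns (suc q) m) i₀ {b B i} →
  a i₀ ≼ b ∷ B → a i ≼ b ∷ B → reduce a i₀ i ≼ B
reduce-≼ a i₀ {i = i} a₀≼ aᵢ≼ t e with a i (suc t) in e₁ | a i₀ (suc t) in e₂
... | true  | _    = aᵢ≼ (suc t) e₁
... | false | true = a₀≼ (suc t) e₂

-- A dependency U′ of the reduced vectors on T - {i₀} lifts to the dependency
-- U′ + σ·{i₀} of the original vectors on T, where σ = Σ_{i ∈ U′} a i zero.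
lift-dependency-reduced : ∀ {m q} (a : Columns (suc q) m) (T : Subset m) i₀ →
  lookup T i₀ ≡ true → a i₀ zero ≡ true →
  ∀ U′ → Dependency (reduce a i₀) (T [ i₀ ]≔ false) U′ → ∃ (Dependency a T)
lift-dependency-reduced a T i₀ i₀∈T pivot-one U′ (U′⊆T′ , (i₁ , i₁∈U′) , ΣU′≡0) =
  U , U⊆T , U≢0 , ΣU≡0
  where
  σ : Bool
  σ = dot (lookup U′) (λ i → a i zero)
  U : Subset _
  U = U′ [ i₀ ]≔ σ
  i₀∉U′ : lookup U′ i₀ ≡ false
  i₀∉U′ = proj₁ (≼-removed T i₀ U′⊆T′)
  U⊆T : lookup U ≼ T
  U⊆T i e with i ≟ i₀
  ... | yes refl = i₀∈T
  ... | no i≢i₀ = proj₂ (≼-removed T i₀ U′⊆T′) i (trans (sym (lookup∘update′ i≢i₀ U′ σ)) e)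
  U≢0 : Nonzero (lookup U)
  U≢0 with i₁ ≟ i₀
  ... | yes refl = ⊥-elim (false≢true (trans (sym i₀∉U′) i₁∈U′))
  ... | no i₁≢i₀ = i₁ , trans (lookup∘update′ i₁≢i₀ U′ σ) i₁∈U′
  sum-U : ∀ t → combo (lookup U) a t ≡ combo (lookup U′) a t xor (σ ∧ a i₀ t)
  sum-U t = trans (dot-update U′ i₀ σ (λ i → a i t))
                  (cong (λ z → combo (lookup U′) a t xor ((z xor σ) ∧ a i₀ t)) i₀∉U′)
  ΣU≡0 : ∀ t → combo (lookup U) a t ≡ false
  ΣU≡0 zero = begin
      combo (lookup U) a zero      ≡⟨ sum-U zero ⟩
      σ xor (σ ∧ a i₀ zero)        ≡⟨ cong (λ z → σ xor (σ ∧ z)) pivot-one ⟩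
      σ xor (σ ∧ true)             ≡⟨ cong (σ xor_) (∧-identityʳ σ) ⟩
      σ xor σ                      ≡⟨ xor-same σ ⟩
      false                        ∎
    where open ≡-Reasoning
  ΣU≡0 (suc t) = begin
      combo (lookup U) a (suc t)
    ≡⟨ sum-U (suc t) ⟩
      combo (lookup U′) a (suc t) xor (σ ∧ a i₀ (suc t))
    ≡⟨ cong (combo (lookup U′) a (suc t) xor_) (∧-comm σ (a i₀ (suc t))) ⟩
      combo (lookup U′) a (suc t) xor (a i₀ (suc t) ∧ σ)
    ≡⟨ cong (combo (lookup U′) a (suc t) xor_) (sym (dot-scaleʳ (lookup U′) (λ i → a i zero) (a i₀ (suc t)))) ⟩
      combo (lookup U′) a (suc t) xor dot (lookup U′) (λ i → a i₀ (suc t) ∧ a i zero)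
    ≡⟨ sym (dot-xorʳ (lookup U′) _ _) ⟩
      combo (lookup U′) (reduce a i₀) t
    ≡⟨ ΣU′≡0 t ⟩
      false
    ∎
    where open ≡-Reasoning

-- Induction on the number q of coordinates: either coordinate zero vanishes on
-- T, or a pivot reduces to q coordinates, one vector fewer and one fewer
-- available coordinate in B.
many-vectors-dependent : ∀ {m} q (a : Columns q m) (B : Subset q) (T : Subset m) →
  (∀ i → lookup T i ≡ true → a i ≼ B) → ∣ B ∣ < ∣ T ∣ → ∃ (Dependency a T)
many-vectors-dependent zero a [] T _ 0<∣T∣ = T , (λ i e → e) , ∣∣>0⇒nonzero T 0<∣T∣ , λ ()
many-vectors-dependent (suc q) a (b ∷ B) T a≼B ∣B∣<∣T∣ with pivot T (λ i → a i zero)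
... | inj₂ zero-on-T =
  let (U , dep) = many-vectors-dependent q (λ i t → a i (suc t)) B T
                    (λ i i∈T t → a≼B i i∈T (suc t)) (ℕ.≤-<-trans (∣p∣≤∣x∷p∣ b B) ∣B∣<∣T∣)
  in U , lift-dependency-tail a T zero-on-T U dep
... | inj₁ (i₀ , i₀∈T , pivot-one) with a≼B i₀ i₀∈T zero pivot-one
...   | refl =
  let T′ = T [ i₀ ]≔ false
      ∣B∣<∣T′∣ = s≤s⁻¹ (subst (suc ∣ b ∷ B ∣ ≤_) (sym (card-remove T i₀ i₀∈T)) ∣B∣<∣T∣)
      (U′ , dep′) = many-vectors-dependent q (reduce a i₀) B T′
                      (λ i i∈T′ → reduce-≼ a i₀ (a≼B i₀ i₀∈T)
                                     (a≼B i (proj₂ (≼-removed T i₀ (λ _ e → e)) i i∈T′)))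
                      ∣B∣<∣T′∣
  in lift-dependency-reduced a T i₀ i₀∈T pivot-one U′ dep′

SpannedBy : ∀ {n m q} → Columns n m → Subset m → Columns n q → Subset q → Set
SpannedBy {q = q} c S d B = ∀ i → ∃ λ (β : Fin q → Bool) →
  lookup S i ≡ true → (β ≼ B) × (∀ j → c i j ≡ combo β d j)

spanned-at : ∀ {n m q} {c : Columns n m} {S} {d : Columns n q} {B} i →
  (lookup S i ≡ true → ∃ λ β → (β ≼ B) × (∀ j → c i j ≡ combo β d j)) →
  ∃ λ β → lookup S i ≡ true → (β ≼ B) × (∀ j → c i j ≡ combo β d j)
spanned-at {S = S} i span-i with lookup S i
... | true  = let (β , h) = span-i refl in β , λ _ → h
... | false = (λ _ → false) , λ ()

dependency-transfer : ∀ {n m q} (c : Columns n m) (d : Columns n q) (a : Columns q m) T →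
  (∀ i → lookup T i ≡ true → ∀ j → c i j ≡ combo (a i) d j) →
  ∀ U → Dependency a T U → Dependency c T U
dependency-transfer c d a T c≡ad U (U⊆T , U≢0 , ΣUa≡0) = U⊆T , U≢0 , λ j → begin
    combo (lookup U) c j
  ≡⟨ dot-cong (λ i → on-U (lookup U i) (λ e → trans (c≡ad i (U⊆T i e) j) (dot-comm (a i) (λ t → d t j)))) ⟩
    dot (lookup U) (λ i → dot (λ t → d t j) (a i))
  ≡⟨ dot-swap (lookup U) (λ t → d t j) a ⟩
    dot (λ t → d t j) (combo (lookup U) a)
  ≡⟨ dot-zero (λ t → trans (cong (d t j ∧_) (ΣUa≡0 t)) (∧-zeroʳ (d t j))) ⟩
    false
  ∎
  where
  open ≡-Reasoning
  on-U : ∀ u {x y} → (u ≡ true → x ≡ y) → u ∧ x ≡ u ∧ y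
  on-U true  h = h refl
  on-U false h = refl

steinitz : ∀ {n m q} {c : Columns n m} {T} {d : Columns n q} {B} →
  SpannedBy c T d B → Independent c T → ∣ T ∣ ≤ ∣ B ∣
steinitz {q = q} {c} {T} {d} {B} span ind with ∣ T ∣ ℕ.≤? ∣ B ∣
... | yes ∣T∣≤∣B∣ = ∣T∣≤∣B∣
... | no ∣T∣≰∣B∣ =
  let (U , dep) = many-vectors-dependent q coefficients B T
                    (λ i i∈T → proj₁ (proj₂ (span i) i∈T)) (ℕ.≰⇒> ∣T∣≰∣B∣)
  in ⊥-elim (independent-sound c U ind
       (dependency-transfer c d coefficients T (λ i i∈T → proj₂ (proj₂ (span i) i∈T)) U dep))
  where
  coefficients : Columns q _
  coefficients i = proj₁ (span i)

rank-≤-span : ∀ {n m q} {c : Columns n m} {S} {d : Columns n q} {B} → SpannedBy c S d B → rank c S ≤ ∣ B ∣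
rank-≤-span {c = c} {S} {d} {B} span = rank-≤ c S _ λ T T⊆S ind →
  steinitz {d = d} {B} (λ i → let (β , h) = span i in β , h ∘ T⊆S i) ind

exchange : ∀ {n m} (c : Columns n m) {B} v → Independent c B → lookup B v ≡ false →
  ∀ U → Dependency c (B [ v ]≔ true) U →
  (lookup (U [ v ]≔ false) ≼ B) × (∀ j → c v j ≡ combo (lookup (U [ v ]≔ false)) c j)
exchange c {B} v indB v∉B U (U⊆B+v , U≢0 , ΣU≡0) with lookup U v in v∈U?
... | false = ⊥-elim (independent-sound c U indB (≼-except B v U⊆B+v v∈U? , U≢0 , ΣU≡0))
... | true  = U-v⊆B , λ j → sym (begin
      combo (lookup (U [ v ]≔ false)) c j
    ≡⟨ dot-update U v false (λ i → c i j) ⟩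
      combo (lookup U) c j xor ((lookup U v xor false) ∧ c v j)
    ≡⟨ cong₂ (λ s u → s xor ((u xor false) ∧ c v j)) (ΣU≡0 j) v∈U? ⟩
      c v j
    ∎)
  where
  open ≡-Reasoning
  U-v⊆B : lookup (U [ v ]≔ false) ≼ B
  U-v⊆B = ≼-except B v (λ i e → U⊆B+v i (proj₂ (≼-removed U v (λ _ e′ → e′)) i e))
                       (lookup∘update v U false)

basis-spans : ∀ {n m} (c : Columns n m) S B → lookup B ≼ S → Independent c B → rank c S ≡ ∣ B ∣ →
  SpannedBy c S c B
basis-spans c S B B⊆S indB rank≡∣B∣ v = spanned-at {c = c} {S} {c} {B} v (span-v (lookup B v) refl)
  where
  span-v : ∀ b → lookup B v ≡ b → lookup S v ≡ true →
    ∃ λ β → (β ≼ B) × (∀ j → c v j ≡ combo β c j)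
  span-v true v∈B _ = (λ t → ⌊ v ≟ t ⌋) , unit≼B , λ j → sym (dot-unitˡ (λ t → c t j) v)
    where
    unit≼B : (λ t → ⌊ v ≟ t ⌋) ≼ B
    unit≼B t e with v ≟ t
    ... | yes refl = v∈B
  span-v false v∉B v∈S with independent c (B [ v ]≔ true) in indB+v?
  ... | true = ⊥-elim (ℕ.<-irrefl (sym rank≡∣B∣) (begin-strict
          ∣ B ∣                 <⟨ ℕ.n<1+n ∣ B ∣ ⟩
          suc ∣ B ∣             ≡⟨ sym (card-add B v v∉B) ⟩
          ∣ B [ v ]≔ true ∣     ≤⟨ rank-≥ c S (B [ v ]≔ true) B+v⊆S indB+v? ⟩
          rank c S              ∎))
    where
    open ℕ.≤-Reasoning
    B+v⊆S : lookup (B [ v ]≔ true) ≼ S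
    B+v⊆S i e with i ≟ v
    ... | yes refl = v∈S
    ... | no i≢v = B⊆S i (trans (sym (lookup∘update′ i≢v B true)) e)
  ... | false =
    let (U , dep) = dependency-witness c (B [ v ]≔ true) indB+v?
    in lookup (U [ v ]≔ false) , exchange c v indB v∉B U dep

-- § Row rank ≤ column rank

-- For u ∈ P, the row (M u j)_{j ∈ Q} of the submatrix M[P, Q]; for v ∈ Q its
-- column (M j v)_{j ∈ P}.
rows cols : ∀ {n} → (Fin n → Fin n → Bool) → Subset n → Columns n n
rows M Q u j = M u j ∧ lookup Q j
cols M P v j = M j v ∧ lookup P j

-- If the columns of M[P, Q] are spanned by those indexed by B, say column j is
-- Σ_{b ∈ β j} column b, then every row u ∈ P equals Σ_{b ∈ B} M u b · ρ b,
-- where ρ b = (β j b)_{j ∈ Q}: the rows are spanned by |B| vectors.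
module _ {n} (M : Fin n → Fin n → Bool) (P Q B : Subset n)
         (span : SpannedBy (cols M P) Q (cols M P) B) where

  row-generators : Columns n n
  row-generators b j = proj₁ (span j) b ∧ lookup Q j

  rows-spanned : SpannedBy (rows M Q) P row-generators B
  rows-spanned u = (λ b → M u b ∧ lookup B b) , λ u∈P → (λ b e → ∧-trueʳ e) , entry u∈P
    where
    β = λ j → proj₁ (span j)
    ∧-trueʳ : ∀ {x y} → x ∧ y ≡ true → y ≡ true
    ∧-trueʳ {true} e = e
    -- a coefficient β j b = 1 forces b ∈ B
    in-B : ∀ m bb b → (b ≡ true → bb ≡ true) → b ∧ (m ∧ true) ≡ (m ∧ bb) ∧ (b ∧ true)
    in-B m bb true h rewrite h refl = ∧-comm true (m ∧ true)
    in-B m bb false h = sym (∧-zeroʳ (m ∧ bb))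
    entry : lookup P u ≡ true → ∀ j → rows M Q u j ≡ combo (λ b → M u b ∧ lookup B b) row-generators j
    entry u∈P j with lookup Q j in j∈Q?
    ... | false = trans (∧-zeroʳ (M u j))
                    (sym (dot-zero (λ b → trans (cong ((M u b ∧ lookup B b) ∧_) (∧-zeroʳ (β j b))) (∧-zeroʳ _))))
    ... | true  = begin
        M u j ∧ true
      ≡⟨ cong (M u j ∧_) (sym u∈P) ⟩
        cols M P j u
      ≡⟨ proj₂ (proj₂ (span j) j∈Q?) u ⟩
        dot (β j) (λ b → M u b ∧ lookup P u)
      ≡⟨ dot-cong (λ b → trans (cong (λ z → β j b ∧ (M u b ∧ z)) u∈P)
                               (in-B (M u b) (lookup B b) (β j b) (proj₁ (proj₂ (span j) j∈Q?) b))) ⟩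
        dot (λ b → M u b ∧ lookup B b) (λ b → β j b ∧ true)
      ∎
      where open ≡-Reasoning

row-rank≤column-rank : ∀ {n} (M : Fin n → Fin n → Bool) (P Q : Subset n) →
  rank (rows M Q) P ≤ rank (cols M P) Q
row-rank≤column-rank M P Q =
  let (B , B⊆Q , indB , rank≡∣B∣) = rank-attained (cols M P) Q
      span = basis-spans (cols M P) Q B B⊆Q indB rank≡∣B∣
  in subst (rank (rows M Q) P ≤_) (sym rank≡∣B∣)
       (rank-≤-span {d = row-generators M P Q B span} {B} (rows-spanned M P Q B span))

by-halves : ∀ {a b} {P : Fin (a + b) → Set} → (∀ k → P (k ↑ˡ b)) → (∀ k → P (a ↑ʳ k)) → ∀ i → P i
by-halves {a} {b} {P} left right i with splitAt a i in eq
... | inj₁ k = subst P (Fin.splitAt⁻¹-↑ˡ eq) (left k)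
... | inj₂ k = subst P (Fin.splitAt⁻¹-↑ʳ eq) (right k)

_⊕_ : ∀ {a b} {C : Set} → (Fin a → C) → (Fin b → C) → Fin (a + b) → C
_⊕_ {a} f g i = [ f , g ]′ (splitAt a i)

⊕-↑ˡ : ∀ {a b} {C : Set} (f : Fin a → C) (g : Fin b → C) k → (f ⊕ g) (k ↑ˡ b) ≡ f k
⊕-↑ˡ {a} {b} f g k rewrite Fin.splitAt-↑ˡ a k b = refl

⊕-↑ʳ : ∀ {a b} {C : Set} (f : Fin a → C) (g : Fin b → C) k → (f ⊕ g) (a ↑ʳ k) ≡ g k
⊕-↑ʳ {a} {b} f g k rewrite Fin.splitAt-↑ʳ a b k = refl

≼-⊕ : ∀ {a b} {f : Fin a → Bool} {g : Fin b → Bool} (X : Subset a) (Y : Subset b) → f ≼ X → g ≼ Y → (f ⊕ g) ≼ X ++ Y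
≼-⊕ {f = f} {g} X Y f≼X g≼Y = by-halves
  (λ k e → trans (lookup-++ˡ X Y k) (f≼X k (trans (sym (⊕-↑ˡ f g k)) e)))
  (λ k e → trans (lookup-++ʳ X Y k) (g≼Y k (trans (sym (⊕-↑ʳ f g k)) e)))

≼-++⁻ˡ : ∀ {a b} {u : Fin (a + b) → Bool} (X : Subset a) (Y : Subset b) → u ≼ X ++ Y → (λ k → u (k ↑ˡ b)) ≼ X
≼-++⁻ˡ X Y u≼ k e = trans (sym (lookup-++ˡ X Y k)) (u≼ _ e)

≼-++⁻ʳ : ∀ {a b} {u : Fin (a + b) → Bool} (X : Subset a) (Y : Subset b) → u ≼ X ++ Y → (λ k → u (a ↑ʳ k)) ≼ Y
≼-++⁻ʳ X Y u≼ k e = trans (sym (lookup-++ʳ X Y k)) (u≼ _ e)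

≼-++ : ∀ {a b} (X X′ : Subset a) {Y Y′ : Subset b} → lookup X ≼ X′ → lookup Y ≼ Y′ → lookup (X ++ Y) ≼ X′ ++ Y′
≼-++ X X′ {Y} {Y′} X⊆X′ Y⊆Y′ = by-halves
  (λ k e → trans (lookup-++ˡ X′ Y′ k) (X⊆X′ k (trans (sym (lookup-++ˡ X Y k)) e)))
  (λ k e → trans (lookup-++ʳ X′ Y′ k) (Y⊆Y′ k (trans (sym (lookup-++ʳ X Y k)) e)))

∣++∣ : ∀ {a b} (X : Subset a) (Y : Subset b) → ∣ X ++ Y ∣ ≡ ∣ X ∣ + ∣ Y ∣
∣++∣ []          Y = refl
∣++∣ (true ∷ X)  Y = cong suc (∣++∣ X Y)
∣++∣ (false ∷ X) Y = ∣++∣ X Y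

module Blocks {n : ℕ} where
  φ χ ψ : Fin n → Fin (n + (n + n))
  φ v = v ↑ˡ (n + n)
  χ v = n ↑ʳ (v ↑ˡ n)
  ψ v = n ↑ʳ (n ↑ʳ v)

  by-blocks : {P : Fin (n + (n + n)) → Set} →
    (∀ v → P (φ v)) → (∀ v → P (χ v)) → (∀ v → P (ψ v)) → ∀ i → P i
  by-blocks pφ pχ pψ = by-halves pφ (by-halves pχ pψ)

  module _ (A : AdjMatrix n) where
    IAS-φ : ∀ v j → IAS A (φ v) j ≡ ⌊ j ≟ v ⌋
    IAS-φ v j rewrite Fin.splitAt-↑ˡ n v (n + n) = refl

    IAS-χ : ∀ v j → IAS A (χ v) j ≡ A j v
    IAS-χ v j rewrite Fin.splitAt-↑ʳ n (n + n) (v ↑ˡ n) | Fin.splitAt-↑ˡ n v n = refl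

    IAS-ψ : ∀ v j → IAS A (ψ v) j ≡ A j v xor ⌊ j ≟ v ⌋
    IAS-ψ v j rewrite Fin.splitAt-↑ʳ n (n + n) (n ↑ʳ v) | Fin.splitAt-↑ʳ n n v = refl

  τ-φ : ∀ (X : Subset n) v → lookup (τ X) (φ v) ≡ lookup X v
  τ-φ X v = lookup-++ˡ X (X ++ X) v

  τ-χ : ∀ (X : Subset n) v → lookup (τ X) (χ v) ≡ lookup X v
  τ-χ X v = trans (lookup-++ʳ X (X ++ X) (v ↑ˡ n)) (lookup-++ˡ X X v)

  τ-ψ : ∀ (X : Subset n) v → lookup (τ X) (ψ v) ≡ lookup X v
  τ-ψ X v = trans (lookup-++ʳ X (X ++ X) (n ↑ʳ v)) (lookup-++ʳ X X v)

open Blocks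

unitCols : ∀ {n} → Columns n n
unitCols v j = ⌊ j ≟ v ⌋

combo-⊕ : ∀ {n a b} (f : Fin a → Bool) (g : Fin b → Bool) (d : Columns n a) (e : Columns n b) j →
  combo (f ⊕ g) (d ⊕ e) j ≡ combo f d j xor combo g e j
combo-⊕ {a = a} f g d e j = trans (dot-split a (f ⊕ g) (λ t → (d ⊕ e) t j)) (cong₂ _xor_
  (dot-cong (λ k → cong₂ _∧_ (⊕-↑ˡ f g k) (cong (λ col → col j) (⊕-↑ˡ d e k))))
  (dot-cong (λ k → cong₂ _∧_ (⊕-↑ʳ f g k) (cong (λ col → col j) (⊕-↑ʳ d e k)))))

combo-IAS : ∀ {n} (A : AdjMatrix n) (u : Fin (n + (n + n)) → Bool) j →
  combo u (IAS A) j ≡ u (φ j) xor (dot (u ∘ χ) (A j) xor dot (u ∘ ψ) (λ v → A j v xor ⌊ j ≟ v ⌋))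
combo-IAS {n} A u j =
  trans (dot-split n u (λ i → IAS A i j)) (cong₂ _xor_
    (trans (dot-cong (λ k → cong (u (φ k) ∧_) (IAS-φ A k j))) (dot-unitʳ (u ∘ φ) j))
    (trans (dot-split n (λ k → u (n ↑ʳ k)) (λ k → IAS A (n ↑ʳ k) j)) (cong₂ _xor_
      (dot-cong (λ k → cong (u (χ k) ∧_) (IAS-χ A k j)))
      (dot-cong (λ k → cong (u (ψ k) ∧_) (IAS-ψ A k j))))))

cutCols : ∀ {n} → AdjMatrix n → Subset n → Columns n n
cutCols A X v j = A j v ∧ not (lookup X j)

split-by-mask : ∀ a m d → ((a ∧ m) xor d) xor (a ∧ not m) ≡ a xor d
split-by-mask true  true  d = xor-identityʳ (not d)
split-by-mask true  false d = xor-comm d true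
split-by-mask false m     d = xor-identityʳ d

masked-or-unit-≼ : ∀ {n} (X : Subset n) (a : Fin n → Bool) s x → lookup X x ≡ true →
  (λ k → (a k ∧ lookup X k) xor (s ∧ ⌊ k ≟ x ⌋)) ≼ X
masked-or-unit-≼ X a s x x∈X k e with lookup X k in k∈X? | k ≟ x
... | true  | _        = refl
... | false | yes refl = trans (sym k∈X?) x∈X
... | false | no _ with trans (sym (cong₂ _xor_ (∧-zeroʳ (a k)) (∧-zeroʳ s))) e
...   | ()

-- § r(τ X) = |X| + c(X)

module RankOfτ {n : ℕ} (A : AdjMatrix n) (X : Subset n) where

  generators : Columns n (n + n)
  generators = unitCols ⊕ cutCols A X

  module _ {B : Subset n} (span : SpannedBy (cutCols A X) X (cutCols A X) B) where

    φ-spanned : ∀ x → lookup X x ≡ true →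
      ∃ λ co → (co ≼ X ++ B) × (∀ j → IAS A (φ x) j ≡ combo co generators j)
    φ-spanned x x∈X = co , ≼-⊕ X B unit≼X (λ _ ()) , λ j → sym (begin
        combo co generators j
      ≡⟨ combo-⊕ (λ k → ⌊ k ≟ x ⌋) (λ _ → false) unitCols (cutCols A X) j ⟩
        combo (λ k → ⌊ k ≟ x ⌋) unitCols j xor combo (λ _ → false) (cutCols A X) j
      ≡⟨ cong₂ _xor_ (dot-unitʳ (λ k → ⌊ k ≟ x ⌋) j)
                     (dot-zero {u = λ _ → false} {λ t → cutCols A X t j} (λ _ → refl)) ⟩
        ⌊ j ≟ x ⌋ xor false
      ≡⟨ xor-identityʳ _ ⟩
        ⌊ j ≟ x ⌋
      ≡⟨ sym (IAS-φ A x j) ⟩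
        IAS A (φ x) j
      ∎)
      where
      open ≡-Reasoning
      co : Fin (n + n) → Bool
      co = (λ k → ⌊ k ≟ x ⌋) ⊕ (λ _ → false)
      unit≼X : (λ k → ⌊ k ≟ x ⌋) ≼ X
      unit≼X k e with k ≟ x
      ... | yes refl = x∈X

    -- For x ∈ X, the column A x + s·eₓ is eₓ·s plus the part of A x on the rows
    -- of X (both sums of unit vectors eₖ, k ∈ X) plus the column x of A[V - X, X],
    -- which the basis B spans.  (s = false gives χ x, s = true gives ψ x.)
    shifted-spanned : ∀ s x → lookup X x ≡ true →
      ∃ λ co → (co ≼ X ++ B) × (∀ j → A j x xor (s ∧ ⌊ j ≟ x ⌋) ≡ combo co generators j)
    shifted-spanned s x x∈X = co , ≼-⊕ X B on-X≼X β≼B , λ j → sym (begin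
        combo co generators j
      ≡⟨ combo-⊕ on-X (proj₁ (span x)) unitCols (cutCols A X) j ⟩
        combo on-X unitCols j xor combo (proj₁ (span x)) (cutCols A X) j
      ≡⟨ cong₂ _xor_ (dot-unitʳ on-X j) (sym (x-spanned j)) ⟩
        ((A j x ∧ lookup X j) xor (s ∧ ⌊ j ≟ x ⌋)) xor (A j x ∧ not (lookup X j))
      ≡⟨ split-by-mask (A j x) (lookup X j) (s ∧ ⌊ j ≟ x ⌋) ⟩
        A j x xor (s ∧ ⌊ j ≟ x ⌋)
      ∎)
      where
      open ≡-Reasoning
      on-X : Fin n → Bool
      on-X k = (A k x ∧ lookup X k) xor (s ∧ ⌊ k ≟ x ⌋)
      co : Fin (n + n) → Bool
      co = on-X ⊕ proj₁ (span x)
      β≼B = proj₁ (proj₂ (span x) x∈X)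
      x-spanned = proj₂ (proj₂ (span x) x∈X)
      on-X≼X : on-X ≼ X
      on-X≼X = masked-or-unit-≼ X (λ k → A k x) s x x∈X

    τ-spanned : SpannedBy (IAS A) (τ X) generators (X ++ B)
    τ-spanned = by-blocks
      (λ x → at (φ x) λ e → φ-spanned x (in-X (τ-φ X x) e))
      (λ x → at (χ x) λ e →
        let (co , co≼ , eq) = shifted-spanned false x (in-X (τ-χ X x) e)
        in co , co≼ , λ j → trans (trans (IAS-χ A x j) (sym (xor-identityʳ (A j x)))) (eq j))
      (λ x → at (ψ x) λ e →
        let (co , co≼ , eq) = shifted-spanned true x (in-X (τ-ψ X x) e)
        in co , co≼ , λ j → trans (IAS-ψ A x j) (eq j))
      where
      at = spanned-at {c = IAS A} {τ X} {generators} {X ++ B}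
      in-X : ∀ {i x} → lookup (τ X) i ≡ lookup X x → lookup (τ X) i ≡ true → lookup X x ≡ true
      in-X τ≡ e = trans (sym τ≡) e

  rank-τ-≤ : rank (IAS A) (τ X) ≤ ∣ X ∣ + cutRank A X
  rank-τ-≤ =
    let (B , B⊆X , indB , rank≡∣B∣) = rank-attained (cutCols A X) X
        span = basis-spans (cutCols A X) X B B⊆X indB rank≡∣B∣
    in subst (rank (IAS A) (τ X) ≤_) (trans (∣++∣ X B) (cong (∣ X ∣ +_) (sym rank≡∣B∣)))
         (rank-≤-span {d = generators} {X ++ B} (τ-spanned {B} span))

  -- If a combination of columns v ∈ B of A vanishes on the rows outside X, then
  -- the combination of the columns of A[V - X, X] vanishes, so for B independent
  -- in A[V - X, X] all coefficients are zero.
  coefficients-vanish : ∀ {B} → Independent (cutCols A X) B → ∀ w → w ≼ B →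
    (∀ j → lookup X j ≡ false → dot w (A j) ≡ false) → ∀ v → w v ≡ false
  coefficients-vanish {B} indB w w≼B off-X v with w v in wv
  ... | false = refl
  ... | true  = ⊥-elim (independent-sound (cutCols A X) W indB (W⊆B , (v , trans (lookup∘tabulate w v) wv) , ΣW≡0))
    where
    W : Subset n
    W = tabulate w
    W⊆B : lookup W ≼ B
    W⊆B i e = w≼B i (trans (sym (lookup∘tabulate w i)) e)
    ΣW≡0 : ∀ j → combo (lookup W) (cutCols A X) j ≡ false
    ΣW≡0 j = begin
        dot (lookup W) (λ i → A j i ∧ not (lookup X j))
      ≡⟨ dot-cong (λ i → cong₂ _∧_ (lookup∘tabulate w i) (∧-comm (A j i) _)) ⟩
        dot w (λ i → not (lookup X j) ∧ A j i)
      ≡⟨ dot-scaleʳ w (A j) (not (lookup X j)) ⟩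
        not (lookup X j) ∧ dot w (A j)
      ≡⟨ outside (lookup X j) refl ⟩
        false
      ∎
      where
      open ≡-Reasoning
      outside : ∀ b → lookup X j ≡ b → not b ∧ dot w (A j) ≡ false
      outside true  _   = refl
      outside false j∉X = off-X j j∉X

  -- φ(X) together with χ(B), for B independent in A[V - X, X], is independent
  -- in M[IAS(G)]: a dependency would restrict, on the rows outside X, to a
  -- dependency of B.
  φX-χB-independent : ∀ {B} → Independent (cutCols A X) B → Independent (IAS A) (X ++ (B ++ ∅))
  φX-χB-independent {B} indB = independent-complete (IAS A) _ no-dependency
    where
    no-dependency : ∀ U → ¬ Dependency (IAS A) (X ++ (B ++ ∅)) U
    no-dependency U (U⊆T , (i , i∈U) , ΣU≡0) = false≢true (trans (sym (u≡0 i)) i∈U)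
      where
      u = lookup U
      uφ≼X : (u ∘ φ) ≼ X
      uφ≼X = ≼-++⁻ˡ X (B ++ ∅) U⊆T
      uχ≼B : (u ∘ χ) ≼ B
      uχ≼B = ≼-++⁻ˡ B ∅ (≼-++⁻ʳ X (B ++ ∅) U⊆T)
      uψ≡0 : ∀ v → u (ψ v) ≡ false
      uψ≡0 v = ≼-outside ∅ (≼-++⁻ʳ B ∅ (≼-++⁻ʳ X (B ++ ∅) U⊆T)) (lookup-replicate v false)
      row : ∀ j → u (φ j) xor dot (u ∘ χ) (A j) ≡ false
      row j = begin
          u (φ j) xor dot (u ∘ χ) (A j)
        ≡⟨ cong (u (φ j) xor_) (sym (xor-identityʳ _)) ⟩
          u (φ j) xor (dot (u ∘ χ) (A j) xor false)
        ≡⟨ cong (λ z → u (φ j) xor (dot (u ∘ χ) (A j) xor z)) (sym (dot-zero (λ v → cong (_∧ _) (uψ≡0 v)))) ⟩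
          u (φ j) xor (dot (u ∘ χ) (A j) xor dot (u ∘ ψ) (λ v → A j v xor ⌊ j ≟ v ⌋))
        ≡⟨ sym (combo-IAS A u j) ⟩
          combo u (IAS A) j
        ≡⟨ ΣU≡0 j ⟩
          false
        ∎
        where open ≡-Reasoning
      uχ≡0 : ∀ v → u (χ v) ≡ false
      uχ≡0 = coefficients-vanish indB (u ∘ χ) uχ≼B λ j j∉X →
        subst (λ z → z xor dot (u ∘ χ) (A j) ≡ false) (≼-outside X uφ≼X j∉X) (row j)
      uφ≡0 : ∀ v → u (φ v) ≡ false
      uφ≡0 j = trans (sym (xor-identityʳ (u (φ j))))
                 (subst (λ z → u (φ j) xor z ≡ false) (dot-zero (λ v → cong (_∧ A j v) (uχ≡0 v))) (row j))
      u≡0 : ∀ i → u i ≡ false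
      u≡0 = by-blocks uφ≡0 uχ≡0 uψ≡0

  rank-τ-≥ : ∣ X ∣ + cutRank A X ≤ rank (IAS A) (τ X)
  rank-τ-≥ =
    let (B , B⊆X , indB , rank≡∣B∣) = rank-attained (cutCols A X) X
    in subst (_≤ rank (IAS A) (τ X))
         (begin
            ∣ X ++ (B ++ ∅) ∣      ≡⟨ ∣++∣ X (B ++ ∅) ⟩
            ∣ X ∣ + ∣ B ++ ∅ ∣     ≡⟨ cong (∣ X ∣ +_) (trans (∣++∣ B ∅) (cong (∣ B ∣ +_) (∣⊥∣≡0 n))) ⟩
            ∣ X ∣ + (∣ B ∣ + 0)    ≡⟨ cong (∣ X ∣ +_) (ℕ.+-identityʳ _) ⟩
            ∣ X ∣ + ∣ B ∣          ≡⟨ cong (∣ X ∣ +_) (sym rank≡∣B∣) ⟩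
            ∣ X ∣ + cutRank A X    ∎)
         (rank-≥ (IAS A) (τ X) (X ++ (B ++ ∅))
            (≼-++ X X (λ _ e → e) (≼-++ B X B⊆X (∅-≼ {S = X})))
            (φX-χB-independent indB))
    where
    open ≡-Reasoning

rank-τ : ∀ {n} (A : AdjMatrix n) X → rank (IAS A) (τ X) ≡ ∣ X ∣ + cutRank A X
rank-τ A X = ℕ.≤-antisym (RankOfτ.rank-τ-≤ A X) (RankOfτ.rank-τ-≥ A X)

rank-of-zero : ∀ {n m} (c : Columns n m) S → (∀ v j → c v j ≡ false) → rank c S ≡ 0
rank-of-zero c S c≡0 = ℕ.n≤0⇒n≡0 (rank-≤ c S 0 no-independent)
  where
  no-independent : ∀ T → lookup T ≼ S → Independent c T → ∣ T ∣ ≤ 0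
  no-independent T _ ind with ∣ T ∣ in ∣T∣≡
  ... | zero  = z≤n
  ... | suc _ = ⊥-elim (independent-sound c T ind ((λ _ e → e) , ∣∣>0⇒nonzero T (subst (0 <_) (sym ∣T∣≡) (s≤s z≤n)) ,
                          λ j → dot-zero (λ v → trans (cong (lookup T v ∧_) (c≡0 v j)) (∧-zeroʳ _))))

replicate-++ : ∀ a b (x : Bool) → replicate (a + b) x ≡ replicate a x ++ replicate b x
replicate-++ zero    b x = refl
replicate-++ (suc a) b x = cong (x ∷_) (replicate-++ a b x)

-- r(M[IAS(G)]) = |V(G)|: the ground set is τ(V(G)), whose cut-rank is 0.
rank-IAS : ∀ {n} (A : AdjMatrix n) → rank (IAS A) full ≡ n
rank-IAS {n} A = begin
    rank (IAS A) full
  ≡⟨ cong (rank (IAS A)) (trans (replicate-++ n (n + n) true) (cong (full {n} ++_) (replicate-++ n n true))) ⟩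
    rank (IAS A) (τ (full {n}))
  ≡⟨ rank-τ A full ⟩
    ∣ full {n} ∣ + cutRank A full
  ≡⟨ cong₂ _+_ (∣⊤∣≡n n) (rank-of-zero (cutCols A full) full no-rows) ⟩
    n + 0
  ≡⟨ ℕ.+-identityʳ n ⟩
    n
  ∎
  where
  open ≡-Reasoning
  no-rows : ∀ v j → cutCols A full v j ≡ false
  no-rows v j = trans (cong (λ b → A j v ∧ not b) (lookup-replicate j true)) (∧-zeroʳ (A j v))

∁-τ : ∀ {n} (X : Subset n) → ∁ (τ X) ≡ τ (∁ X)
∁-τ X = trans (map-++ not X (X ++ X)) (cong (map not X ++_) (map-++ not X X))

-- For symmetric A the submatrices A[Q, P] and A[P, Q] are transposes, so by
-- row rank ≤ column rank the ranks of their column sets compare.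
symmetric-rank-swap : ∀ {n} (A : AdjMatrix n) → Symmetric A → ∀ P Q → rank (cols A P) Q ≤ rank (cols A Q) P
symmetric-rank-swap A symA P Q =
  subst (_≤ rank (cols A Q) P) (rank-cong (λ v j → cong (_∧ lookup P j) (sym (symA j v))) Q)
        (row-rank≤column-rank A Q P)

cutRank-∁ : ∀ {n} (A : AdjMatrix n) → Symmetric A → ∀ X → cutRank A (∁ X) ≡ cutRank A X
cutRank-∁ A symA X = ℕ.≤-antisym
  (subst₂ _≤_ (sym c∁X≡) (sym cX≡) (symmetric-rank-swap A symA X (∁ X)))
  (subst₂ _≤_ (sym cX≡) (sym c∁X≡) (symmetric-rank-swap A symA (∁ X) X))
  where
  cX≡ : cutRank A X ≡ rank (cols A (∁ X)) X
  cX≡ = rank-cong (λ v j → cong (A j v ∧_) (sym (lookup-map j not X))) X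
  c∁X≡ : cutRank A (∁ X) ≡ rank (cols A X) (∁ X)
  c∁X≡ = rank-cong (λ v j → cong (A j v ∧_) (trans (cong not (lookup-map j not X)) (not-involutive _))) (∁ X)

module Separation {n : ℕ} (A : AdjMatrix n) (symA : Symmetric A) (X : Subset n) where
  c x y : ℕ
  c = cutRank A X
  x = ∣ X ∣
  y = ∣ ∁ X ∣

  rank-∁τX : rank (IAS A) (∁ (τ X)) ≡ y + c
  rank-∁τX = trans (cong (rank (IAS A)) (∁-τ X)) (trans (rank-τ A (∁ X)) (cong (y +_) (cutRank-∁ A symA X)))

  -- λ(τ X) = (|X| + c) + (|V - X| + c) - |V| = 2c.
  connectivity-τX : connectivity (IAS A) (τ X) ≡ c + c
  connectivity-τX = begin
      (rank (IAS A) (τ X) + rank (IAS A) (∁ (τ X))) ∸ rank (IAS A) _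
    ≡⟨ cong₂ _∸_ (cong₂ _+_ (rank-τ A X) rank-∁τX) (rank-IAS A) ⟩
      ((x + c) + (y + c)) ∸ n
    ≡⟨ cong (_∸ n) (trans (+-interchange x c y c) (cong (_+ (c + c)) ∣X∣+∣∁X∣≡n)) ⟩
      (n + (c + c)) ∸ n
    ≡⟨ ℕ.m+n∸m≡n n (c + c) ⟩
      c + c
    ∎
    where
    open ≡-Reasoning
    ∣X∣+∣∁X∣≡n : x + y ≡ n
    ∣X∣+∣∁X∣≡n = trans (cong (x +_) (∣∁p∣≡n∸∣p∣ X)) (ℕ.m+[n∸m]≡n (∣p∣≤n X))

  -- 2c + 1 = 1 + 2c, the form the order relations below produce.
  2c+1≡ : 2 * c + 1 ≡ suc (c + c)
  2c+1≡ = trans (ℕ.+-comm (2 * c) 1) (cong (λ z → suc (c + z)) (ℕ.+-identityʳ c))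

  separation-bound : ∀ k → VerticalSeparation (IAS A) k (τ X) → 2 * c + 1 ≤ k
  separation-bound k (λ<k , _ , _) = subst (_≤ k) (trans (cong suc connectivity-τX) (sym 2c+1≡)) λ<k

  -- ... and k ≤ min(r(τ X), r(∁ τ X)) = min(|X|, |V - X|) + c, forcing c < min(|X|, |V - X|).
  separation-forces-small-cut : ∀ k → VerticalSeparation (IAS A) k (τ X) → c < x ⊓ y
  separation-forces-small-cut k sep@(_ , k≤r₁ , k≤r₂) =
    ℕ.⊓-glb (c<side x (rank-τ A X) k≤r₁) (c<side y rank-∁τX k≤r₂)
    where
    c<side : ∀ s {r} → r ≡ s + c → k ≤ r → c < s
    c<side s r≡ k≤r = ℕ.+-cancelʳ-≤ c (suc c) s (begin
      suc c + c        ≡⟨⟩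
      suc (c + c)      ≡⟨ sym 2c+1≡ ⟩
      2 * c + 1        ≤⟨ separation-bound k sep ⟩
      k                ≤⟨ k≤r ⟩
      _                ≡⟨ r≡ ⟩
      s + c            ∎)
      where open ℕ.≤-Reasoning

  separation-at-2c+1 : c < x ⊓ y → VerticalSeparation (IAS A) (2 * c + 1) (τ X)
  separation-at-2c+1 c<min =
    subst (_< 2 * c + 1) (sym connectivity-τX) (ℕ.≤-reflexive (sym 2c+1≡)) ,
    side-≤ x (rank-τ A X) (ℕ.m<n⊓o⇒m<n x y c<min) ,
    side-≤ y rank-∁τX (ℕ.m<n⊓o⇒m<o x y c<min)
    where
    side-≤ : ∀ s {r} → r ≡ s + c → c < s → 2 * c + 1 ≤ r
    side-≤ s r≡ c<s = begin
      2 * c + 1        ≡⟨ 2c+1≡ ⟩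
      suc c + c        ≤⟨ ℕ.+-monoˡ-≤ c c<s ⟩
      s + c            ≡⟨ sym r≡ ⟩
      _                ∎
      where open ℕ.≤-Reasoning

proposition16 : (n : ℕ) (A : AdjMatrix n) → Symmetric A → (X : Subset n) →
    ((cutRank A X < ∣ X ∣ ⊓ ∣ ∁ X ∣) ⇔ (∃[ k ] (1 ≤ k × VerticalSeparation (IAS A) k (τ X))))
    × (cutRank A X < ∣ X ∣ ⊓ ∣ ∁ X ∣ →
        VerticalSeparation (IAS A) (2 * cutRank A X + 1) (τ X)
        × ((k : ℕ) → VerticalSeparation (IAS A) k (τ X) → 2 * cutRank A X + 1 ≤ k))
proposition16 n A symA X =
  mk⇔ (λ small → 2 * c + 1 , 1≤2c+1 , separation-at-2c+1 small)
      (λ (k , _ , sep) → separation-forces-small-cut k sep) ,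
  λ small → separation-at-2c+1 small , separation-bound
  where
  open Separation A symA X
  1≤2c+1 : 1 ≤ 2 * c + 1
  1≤2c+1 = subst (1 ≤_) (sym 2c+1≡) (s≤s z≤n)
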